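{- For every derivation $\mathcal{D} \in \mathsf{PLL}$, there is a cut-free derivation $\mathcal{D}'\in\mathsf{PLL}$ such that $\mathcal{D}\to_{\mathsf{cut}}^*\mathcal{D}'$.
   Context: Formulas are those of propositional multiplicative-exponential linear logic with units: $A,B ::= X \mid X^\perp \mid A\otimes B \mid A ⅋ B \mid {!A} \mid {?A} \mid \mathbf{1} \mid \bot$, where $X$ ranges over propositional variables and $⅋$ denotes the multiplicative disjunction ("par"); linear negation $(\cdot)^\perp$ is involutive and defined by De Morgan laws ($(A\otimes B)^\perp = A^\perp ⅋ B^\perp$, $(!A)^\perp = ?A^\perp$, $\mathbf{1}^\perp=\bot$). Sequents are sets of formula occurrences. Parsimonious linear logic $\mathsf{PLL}$ is the set of finite derivations built from the rules: axiom ($\vdash A, A^\perp$), cut (from $\Gamma,A$ and $A^\perp,\Delta$ infer $\Gamma,\Delta$), $⅋$ (from $\Gamma,A,B$ infer $\Gamma,A⅋B$), $\otimes$ (from $\Gamma,A$ and $B,\Delta$ infer $\Gamma,\Delta,A\otimes B$), $\mathbf{1}$ ($\vdash\mathbf{1}$), $\bot$ (from $\Gamma$ infer $\Gamma,\bot$), functorial promotion $\mathsf{fp}$ (from $\Gamma,A$ infer $?\Gamma,!A$), weakening $?\mathsf{w}$ (from $\Gamma$ infer $\Gamma,?A$) and absorption $?\mathsf{b}$ (from $\Gamma,A,?A$ infer $\Gamma,?A$). The cut-elimination relation $\to_{\mathsf{cut}}$ (with reflexive-transitive closure $\to_{\mathsf{cut}}^*$) is the union of: the multiplicative principal steps (a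 cut with an axiom disappears; a cut between $⅋$ and $\otimes$ on $A⅋B$ / $A^\perp\otimes B^\perp$ becomes two cuts on $A$ and $B$; a cut between $\bot$ and $\mathbf{1}$ disappears); the exponential principal steps ($\mathsf{fp}$ vs $\mathsf{fp}$: a cut between $\mathsf{fp}$ on $\Gamma,A$ and $\mathsf{fp}$ on $A^\perp,\Delta,B$ becomes an $\mathsf{fp}$ applied to the cut of their premises; $\mathsf{fp}$ vs $?\mathsf{w}$: becomes weakenings introducing $?\Gamma$; $\mathsf{fp}$ vs $?\mathsf{b}$ with premises $\Gamma,A$ and $\Delta,A^\perp,?A^\perp$: becomes absorptions on $?\Gamma$ applied to the cut of $\Gamma,A$ with the cut of the $\mathsf{fp}$-derivation of $?\Gamma,!A$ and $\Delta,A^\perp,?A^\perp$); and the commutative steps, which permute a cut above a rule $\mathsf{r}\neq\mathsf{cut}$ whose principal formula is not the cut formula. -}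

module Defs where

open import Data.Nat using (ℕ)
open import Data.Product using (_×_)
open import Data.Unit using (⊤)
open import Data.Empty using () renaming (⊥ to Empty)
open import Data.List using (List; []; _∷_; _++_; map)
open import Data.List.Properties using (++-assoc)
open import Data.List.Relation.Unary.Any using (here; there)
open import Data.List.Membership.Propositional using (_∈_; _─_)
open import Data.List.Membership.Propositional.Properties using (∈-map⁺; ∈-++⁺ˡ; ∈-++⁺ʳ)
open import Data.List.Relation.Binary.Permutation.Propositional
  using (_↭_; refl; prep; swap; trans; ↭-sym; ↭-reflexive)
open import Data.List.Relation.Binary.Permutation.Propositional.Properties
  using (∈-resp-↭; shift; ++-comm; ++⁺ˡ)
open import Relation.Binary.PropositionalEquality using (_≡_) renaming (refl to ≡-refl)
open import Relation.Binary.Construct.Closure.ReflexiveTransitive using (Star)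

infixr 25 _⊗_ _⅋_
infix 30 !_ ¿_
infix 40 _ᗮ

data Fm : Set where
  var  : ℕ → Fm
  nvar : ℕ → Fm
  _⊗_  : Fm → Fm → Fm
  _⅋_  : Fm → Fm → Fm
  !_   : Fm → Fm
  ¿_   : Fm → Fm
  𝟏    : Fm
  ⊥    : Fm

_ᗮ : Fm → Fm
var x ᗮ   = nvar x
nvar x ᗮ  = var x
(A ⊗ B) ᗮ = A ᗮ ⅋ B ᗮ
(A ⅋ B) ᗮ = A ᗮ ⊗ B ᗮ
(! A) ᗮ   = ¿ (A ᗮ)
(¿ A) ᗮ   = ! (A ᗮ)
𝟏 ᗮ       = ⊥
⊥ ᗮ       = 𝟏

¿[_] : List Fm → List Fm
¿[ Γ ] = map ¿_ Γ

-- Sequents are multisets of formula occurrences, represented by lists.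
-- Every rule has its premises in a canonical order (active formulas in
-- front) and its conclusion Θ is given together with an explicit
-- bijection (permutation witness) of the occurrences of Θ with the
-- canonical conclusion (principal formula in front, then the contexts).

infix 5 ⊢_

data ⊢_ : List Fm → Set where
  ax  : ∀ {Θ} A → Θ ↭ A ∷ A ᗮ ∷ [] → ⊢ Θ
  cut : ∀ {Γ Δ Θ} A → ⊢ A ∷ Γ → ⊢ A ᗮ ∷ Δ → Θ ↭ Γ ++ Δ → ⊢ Θ
  par : ∀ {Γ Θ} A B → ⊢ A ∷ B ∷ Γ → Θ ↭ A ⅋ B ∷ Γ → ⊢ Θ
  ten : ∀ {Γ Δ Θ} A B → ⊢ A ∷ Γ → ⊢ B ∷ Δ → Θ ↭ A ⊗ B ∷ Γ ++ Δ → ⊢ Θ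
  one : ∀ {Θ} → Θ ↭ 𝟏 ∷ [] → ⊢ Θ
  bot : ∀ {Γ Θ} → ⊢ Γ → Θ ↭ ⊥ ∷ Γ → ⊢ Θ
  fp  : ∀ {Γ Θ} A → ⊢ A ∷ Γ → Θ ↭ ! A ∷ ¿[ Γ ] → ⊢ Θ
  wk  : ∀ {Γ Θ} A → ⊢ Γ → Θ ↭ ¿ A ∷ Γ → ⊢ Θ
  ab  : ∀ {Γ Θ} A → ⊢ A ∷ ¿ A ∷ Γ → Θ ↭ ¿ A ∷ Γ → ⊢ Θ

CutFree : ∀ {Θ} → ⊢ Θ → Set
CutFree (ax A ρ)          = ⊤
CutFree (cut A D E ρ)     = Empty
CutFree (par A B D ρ)     = CutFree D
CutFree (ten A B D E ρ)   = CutFree D × CutFree E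
CutFree (one ρ)           = ⊤
CutFree (bot D ρ)         = CutFree D
CutFree (fp A D ρ)        = CutFree D
CutFree (wk A D ρ)        = CutFree D
CutFree (ab A D ρ)        = CutFree D

exch : ∀ {Θ Θ'} → Θ ↭ Θ' → ⊢ Θ → ⊢ Θ'
exch τ (ax A ρ)        = ax A (trans (↭-sym τ) ρ)
exch τ (cut A D E ρ)   = cut A D E (trans (↭-sym τ) ρ)
exch τ (par A B D ρ)   = par A B D (trans (↭-sym τ) ρ)
exch τ (ten A B D E ρ) = ten A B D E (trans (↭-sym τ) ρ)
exch τ (one ρ)         = one (trans (↭-sym τ) ρ)
exch τ (bot D ρ)       = bot D (trans (↭-sym τ) ρ)
exch τ (fp A D ρ)      = fp A D (trans (↭-sym τ) ρ)
exch τ (wk A D ρ)      = wk A D (trans (↭-sym τ) ρ)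
exch τ (ab A D ρ)      = ab A D (trans (↭-sym τ) ρ)

extract : ∀ {A : Fm} {Γ} (p : A ∈ Γ) → Γ ↭ A ∷ (Γ ─ p)
extract (here ≡-refl)   = refl
extract {Γ = B ∷ Γ} (there p) = trans (prep B (extract p)) (swap B _ refl)

extract₁ : ∀ {A B : Fm} {Γ} (p : A ∈ Γ) → B ∷ Γ ↭ A ∷ B ∷ (Γ ─ p)
extract₁ {B = B} p = trans (prep B (extract p)) (swap B _ refl)

extract₂ : ∀ {A B C : Fm} {Γ} (p : A ∈ Γ) → B ∷ C ∷ Γ ↭ A ∷ B ∷ C ∷ (Γ ─ p)
extract₂ {B = B} {C = C} p = trans (prep B (extract₁ {B = C} p)) (swap B _ refl)

shift₂ : ∀ (B C : Fm) Γ X → Γ ++ B ∷ C ∷ X ↭ B ∷ C ∷ Γ ++ X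
shift₂ B C Γ X = trans (shift B Γ (C ∷ X)) (prep B (shift C Γ X))

wks : ∀ Γ {Δ} → ⊢ Δ → ⊢ ¿[ Γ ] ++ Δ
wks []      D = D
wks (G ∷ Γ) D = wk G (wks Γ D) refl

abs* : ∀ Γ {Δ} → ⊢ Γ ++ ¿[ Γ ] ++ Δ → ⊢ ¿[ Γ ] ++ Δ
abs* []      D = D
abs* (G ∷ Γ) {Δ} D =
  exch (shift (¿ G) ¿[ Γ ] Δ)
    (abs* Γ {¿ G ∷ Δ}
      (ab G (exch (prep G (shift (¿ G) Γ (¿[ Γ ] ++ Δ))) D)
         (trans (↭-reflexive (≡-sym-assoc Γ))
           (trans (shift (¿ G) (Γ ++ ¿[ Γ ]) Δ) (prep (¿ G) (↭-reflexive (++-assoc Γ ¿[ Γ ] Δ)))))))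
  where
  ≡-sym-assoc : ∀ Γ → Γ ++ ¿[ Γ ] ++ ¿ G ∷ Δ ≡ (Γ ++ ¿[ Γ ]) ++ ¿ G ∷ Δ
  ≡-sym-assoc Γ = Relation.Binary.PropositionalEquality.sym (++-assoc Γ ¿[ Γ ] (¿ G ∷ Δ))
    where import Relation.Binary.PropositionalEquality

-- "hd ρ" : the occurrence in front of the source of ρ is sent to the
-- front (principal position) of the canonical conclusion, i.e. the
-- cut formula is the principal formula of the rule.
-- Exchange witnesses of the final conclusion of a reduct (σ) are
-- arbitrary: only the bijection of the conclusion occurrences is not
-- recorded; all active occurrences are tracked exactly.

Hd : ∀ {A : Fm} {Γ Γ₀} → A ∷ Γ ↭ A ∷ Γ₀ → Set
Hd ρ = ∈-resp-↭ ρ (here ≡-refl) ≡ here ≡-refl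

infix 4 _⟶_ _⟶*_

data _⟶_ : ∀ {Θ} → ⊢ Θ → ⊢ Θ → Set where

  ax-l : ∀ {A B Γ Δ Θ} {ρ : A ∷ Γ ↭ B ∷ B ᗮ ∷ []} {E : ⊢ A ᗮ ∷ Δ} {κ : Θ ↭ Γ ++ Δ}
       → (σ : A ᗮ ∷ Δ ↭ Θ)
       → cut A (ax B ρ) E κ ⟶ exch σ E
  ax-r : ∀ {A B Γ Δ Θ} {D : ⊢ A ∷ Γ} {ρ : A ᗮ ∷ Δ ↭ B ∷ B ᗮ ∷ []} {κ : Θ ↭ Γ ++ Δ}
       → (σ : A ∷ Γ ↭ Θ)
       → cut A D (ax B ρ) κ ⟶ exch σ D
  par-ten : ∀ {B C Γ Γ₀ Δ Δ₁ Δ₂ Θ} {D₀ : ⊢ B ∷ C ∷ Γ₀} {ρ : B ⅋ C ∷ Γ ↭ B ⅋ C ∷ Γ₀}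
              {E₁ : ⊢ B ᗮ ∷ Δ₁} {E₂ : ⊢ C ᗮ ∷ Δ₂}
              {ρ' : B ᗮ ⊗ C ᗮ ∷ Δ ↭ B ᗮ ⊗ C ᗮ ∷ Δ₁ ++ Δ₂} {κ : Θ ↭ Γ ++ Δ}
          → Hd ρ → Hd ρ'
          → (σ : Θ ↭ (Γ₀ ++ Δ₁) ++ Δ₂)
          → cut (B ⅋ C) (par B C D₀ ρ) (ten (B ᗮ) (C ᗮ) E₁ E₂ ρ') κ
            ⟶ cut C (cut B D₀ E₁ refl) E₂ σ
  ten-par : ∀ {B C Γ Γ₁ Γ₂ Δ Δ₀ Θ} {D₁ : ⊢ B ∷ Γ₁} {D₂ : ⊢ C ∷ Γ₂}
              {ρ : B ⊗ C ∷ Γ ↭ B ⊗ C ∷ Γ₁ ++ Γ₂}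
              {E₀ : ⊢ B ᗮ ∷ C ᗮ ∷ Δ₀} {ρ' : B ᗮ ⅋ C ᗮ ∷ Δ ↭ B ᗮ ⅋ C ᗮ ∷ Δ₀} {κ : Θ ↭ Γ ++ Δ}
          → Hd ρ → Hd ρ'
          → (σ : Θ ↭ Γ₂ ++ Γ₁ ++ Δ₀)
          → cut (B ⊗ C) (ten B C D₁ D₂ ρ) (par (B ᗮ) (C ᗮ) E₀ ρ') κ
            ⟶ cut C D₂ (cut B D₁ E₀ (↭-sym (shift (C ᗮ) Γ₁ Δ₀))) σ
  bot-one : ∀ {Γ Γ₀ Δ Θ} {D₀ : ⊢ Γ₀} {ρ : ⊥ ∷ Γ ↭ ⊥ ∷ Γ₀} {ρ' : 𝟏 ∷ Δ ↭ 𝟏 ∷ []}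
              {κ : Θ ↭ Γ ++ Δ}
          → Hd ρ
          → (σ : Γ₀ ↭ Θ)
          → cut ⊥ (bot D₀ ρ) (one ρ') κ ⟶ exch σ D₀
  one-bot : ∀ {Γ Δ Δ₀ Θ} {ρ' : 𝟏 ∷ Γ ↭ 𝟏 ∷ []} {E₀ : ⊢ Δ₀} {ρ : ⊥ ∷ Δ ↭ ⊥ ∷ Δ₀}
              {κ : Θ ↭ Γ ++ Δ}
          → Hd ρ
          → (σ : Δ₀ ↭ Θ)
          → cut 𝟏 (one ρ') (bot E₀ ρ) κ ⟶ exch σ E₀

  fp-fp : ∀ {B C Γ Γ₀ Δ Δ₀ Θ} {D₀ : ⊢ B ∷ Γ₀} {ρ : ! B ∷ Γ ↭ ! B ∷ ¿[ Γ₀ ]}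
            {E₀ : ⊢ C ∷ Δ₀} {ρ' : ¿ (B ᗮ) ∷ Δ ↭ ! C ∷ ¿[ Δ₀ ]} {κ : Θ ↭ Γ ++ Δ}
        → Hd ρ
        → (q : B ᗮ ∈ Δ₀) → ∈-resp-↭ ρ' (here ≡-refl) ≡ there (∈-map⁺ ¿_ q)
        → (σ : Θ ↭ ! C ∷ ¿[ Γ₀ ++ (Δ₀ ─ q) ])
        → cut (! B) (fp B D₀ ρ) (fp C E₀ ρ') κ
          ⟶ fp C (cut B D₀ (exch (extract₁ q) E₀) (↭-sym (shift C Γ₀ (Δ₀ ─ q)))) σ
  fp-fp' : ∀ {B C Γ Γ₀ Δ Δ₀ Θ} {E₀ : ⊢ C ∷ Δ₀} {ρ' : ¿ B ∷ Γ ↭ ! C ∷ ¿[ Δ₀ ]}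
             {D₀ : ⊢ B ᗮ ∷ Γ₀} {ρ : ! (B ᗮ) ∷ Δ ↭ ! (B ᗮ) ∷ ¿[ Γ₀ ]} {κ : Θ ↭ Γ ++ Δ}
         → Hd ρ
         → (q : B ∈ Δ₀) → ∈-resp-↭ ρ' (here ≡-refl) ≡ there (∈-map⁺ ¿_ q)
         → (σ : Θ ↭ ! C ∷ ¿[ (Δ₀ ─ q) ++ Γ₀ ])
         → cut (¿ B) (fp C E₀ ρ') (fp (B ᗮ) D₀ ρ) κ
           ⟶ fp C (cut B (exch (extract₁ q) E₀) D₀ refl) σ
  fp-wk : ∀ {B Γ Γ₀ Δ Δ₀ Θ} {D₀ : ⊢ B ∷ Γ₀} {ρ : ! B ∷ Γ ↭ ! B ∷ ¿[ Γ₀ ]}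
            {E₀ : ⊢ Δ₀} {ρ' : ¿ (B ᗮ) ∷ Δ ↭ ¿ (B ᗮ) ∷ Δ₀} {κ : Θ ↭ Γ ++ Δ}
        → Hd ρ → Hd ρ'
        → (σ : ¿[ Γ₀ ] ++ Δ₀ ↭ Θ)
        → cut (! B) (fp B D₀ ρ) (wk (B ᗮ) E₀ ρ') κ ⟶ exch σ (wks Γ₀ E₀)
  wk-fp : ∀ {B Γ Γ₀ Δ Δ₀ Θ} {E₀ : ⊢ Δ₀} {ρ' : ¿ B ∷ Γ ↭ ¿ B ∷ Δ₀}
            {D₀ : ⊢ B ᗮ ∷ Γ₀} {ρ : ! (B ᗮ) ∷ Δ ↭ ! (B ᗮ) ∷ ¿[ Γ₀ ]} {κ : Θ ↭ Γ ++ Δ}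
        → Hd ρ → Hd ρ'
        → (σ : ¿[ Γ₀ ] ++ Δ₀ ↭ Θ)
        → cut (¿ B) (wk B E₀ ρ') (fp (B ᗮ) D₀ ρ) κ ⟶ exch σ (wks Γ₀ E₀)
  fp-ab : ∀ {B Γ Γ₀ Δ Δ₀ Θ} {D₀ : ⊢ B ∷ Γ₀} {ρ : ! B ∷ Γ ↭ ! B ∷ ¿[ Γ₀ ]}
            {E₀ : ⊢ B ᗮ ∷ ¿ (B ᗮ) ∷ Δ₀} {ρ' : ¿ (B ᗮ) ∷ Δ ↭ ¿ (B ᗮ) ∷ Δ₀} {κ : Θ ↭ Γ ++ Δ}
        → Hd ρ → Hd ρ'
        → (σ : ¿[ Γ₀ ] ++ Δ₀ ↭ Θ)
        → cut (! B) (fp B D₀ ρ) (ab (B ᗮ) E₀ ρ') κ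
          ⟶ exch σ (abs* Γ₀
               (cut B D₀
                  (cut (! B) (fp B D₀ refl) (exch (swap (B ᗮ) (¿ (B ᗮ)) refl) E₀)
                       (↭-sym (shift (B ᗮ) ¿[ Γ₀ ] Δ₀)))
                  refl))
  ab-fp : ∀ {B Γ Γ₀ Δ Δ₀ Θ} {E₀ : ⊢ B ∷ ¿ B ∷ Δ₀} {ρ' : ¿ B ∷ Γ ↭ ¿ B ∷ Δ₀}
            {D₀ : ⊢ B ᗮ ∷ Γ₀} {ρ : ! (B ᗮ) ∷ Δ ↭ ! (B ᗮ) ∷ ¿[ Γ₀ ]} {κ : Θ ↭ Γ ++ Δ}
        → Hd ρ → Hd ρ'
        → (σ : ¿[ Γ₀ ] ++ Δ₀ ↭ Θ)
        → cut (¿ B) (ab B E₀ ρ') (fp (B ᗮ) D₀ ρ) κ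
          ⟶ exch σ (abs* Γ₀
               (cut B
                  (cut (¿ B) (exch (swap B (¿ B) refl) E₀) (fp (B ᗮ) D₀ refl) refl)
                  D₀
                  (trans (++⁺ˡ Γ₀ (++-comm ¿[ Γ₀ ] Δ₀)) (++-comm Γ₀ (Δ₀ ++ ¿[ Γ₀ ])))))

  c-par-l : ∀ {A B C Γ Γ₀ Δ Θ} {D₀ : ⊢ B ∷ C ∷ Γ₀} {ρ : A ∷ Γ ↭ B ⅋ C ∷ Γ₀}
              {E : ⊢ A ᗮ ∷ Δ} {κ : Θ ↭ Γ ++ Δ}
          → (q : A ∈ Γ₀) → ∈-resp-↭ ρ (here ≡-refl) ≡ there q
          → (σ : Θ ↭ B ⅋ C ∷ (Γ₀ ─ q) ++ Δ)
          → cut A (par B C D₀ ρ) E κ ⟶ par B C (cut A (exch (extract₂ q) D₀) E refl) σ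
  c-ten-l₁ : ∀ {A B C Γ Γ₁ Γ₂ Δ Θ} {D₁ : ⊢ B ∷ Γ₁} {D₂ : ⊢ C ∷ Γ₂}
               {ρ : A ∷ Γ ↭ B ⊗ C ∷ Γ₁ ++ Γ₂} {E : ⊢ A ᗮ ∷ Δ} {κ : Θ ↭ Γ ++ Δ}
           → (q : A ∈ Γ₁) → ∈-resp-↭ ρ (here ≡-refl) ≡ there (∈-++⁺ˡ q)
           → (σ : Θ ↭ B ⊗ C ∷ ((Γ₁ ─ q) ++ Δ) ++ Γ₂)
           → cut A (ten B C D₁ D₂ ρ) E κ
             ⟶ ten B C (cut A (exch (extract₁ q) D₁) E refl) D₂ σ
  c-ten-l₂ : ∀ {A B C Γ Γ₁ Γ₂ Δ Θ} {D₁ : ⊢ B ∷ Γ₁} {D₂ : ⊢ C ∷ Γ₂}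
               {ρ : A ∷ Γ ↭ B ⊗ C ∷ Γ₁ ++ Γ₂} {E : ⊢ A ᗮ ∷ Δ} {κ : Θ ↭ Γ ++ Δ}
           → (q : A ∈ Γ₂) → ∈-resp-↭ ρ (here ≡-refl) ≡ there (∈-++⁺ʳ Γ₁ q)
           → (σ : Θ ↭ B ⊗ C ∷ Γ₁ ++ (Γ₂ ─ q) ++ Δ)
           → cut A (ten B C D₁ D₂ ρ) E κ
             ⟶ ten B C D₁ (cut A (exch (extract₁ q) D₂) E refl) σ
  c-bot-l : ∀ {A Γ Γ₀ Δ Θ} {D₀ : ⊢ Γ₀} {ρ : A ∷ Γ ↭ ⊥ ∷ Γ₀}
              {E : ⊢ A ᗮ ∷ Δ} {κ : Θ ↭ Γ ++ Δ}
          → (q : A ∈ Γ₀) → ∈-resp-↭ ρ (here ≡-refl) ≡ there q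
          → (σ : Θ ↭ ⊥ ∷ (Γ₀ ─ q) ++ Δ)
          → cut A (bot D₀ ρ) E κ ⟶ bot (cut A (exch (extract q) D₀) E refl) σ
  c-wk-l : ∀ {A B Γ Γ₀ Δ Θ} {D₀ : ⊢ Γ₀} {ρ : A ∷ Γ ↭ ¿ B ∷ Γ₀}
             {E : ⊢ A ᗮ ∷ Δ} {κ : Θ ↭ Γ ++ Δ}
         → (q : A ∈ Γ₀) → ∈-resp-↭ ρ (here ≡-refl) ≡ there q
         → (σ : Θ ↭ ¿ B ∷ (Γ₀ ─ q) ++ Δ)
         → cut A (wk B D₀ ρ) E κ ⟶ wk B (cut A (exch (extract q) D₀) E refl) σ
  c-ab-l : ∀ {A B Γ Γ₀ Δ Θ} {D₀ : ⊢ B ∷ ¿ B ∷ Γ₀} {ρ : A ∷ Γ ↭ ¿ B ∷ Γ₀}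
             {E : ⊢ A ᗮ ∷ Δ} {κ : Θ ↭ Γ ++ Δ}
         → (q : A ∈ Γ₀) → ∈-resp-↭ ρ (here ≡-refl) ≡ there q
         → (σ : Θ ↭ ¿ B ∷ (Γ₀ ─ q) ++ Δ)
         → cut A (ab B D₀ ρ) E κ ⟶ ab B (cut A (exch (extract₂ q) D₀) E refl) σ

  c-par-r : ∀ {A B C Γ Δ Δ₀ Θ} {D : ⊢ A ∷ Γ} {E₀ : ⊢ B ∷ C ∷ Δ₀}
              {ρ : A ᗮ ∷ Δ ↭ B ⅋ C ∷ Δ₀} {κ : Θ ↭ Γ ++ Δ}
          → (q : A ᗮ ∈ Δ₀) → ∈-resp-↭ ρ (here ≡-refl) ≡ there q
          → (σ : Θ ↭ B ⅋ C ∷ Γ ++ (Δ₀ ─ q))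
          → cut A D (par B C E₀ ρ) κ
            ⟶ par B C (cut A D (exch (extract₂ q) E₀) (↭-sym (shift₂ B C Γ (Δ₀ ─ q)))) σ
  c-ten-r₁ : ∀ {A B C Γ Δ Δ₁ Δ₂ Θ} {D : ⊢ A ∷ Γ} {E₁ : ⊢ B ∷ Δ₁} {E₂ : ⊢ C ∷ Δ₂}
               {ρ : A ᗮ ∷ Δ ↭ B ⊗ C ∷ Δ₁ ++ Δ₂} {κ : Θ ↭ Γ ++ Δ}
           → (q : A ᗮ ∈ Δ₁) → ∈-resp-↭ ρ (here ≡-refl) ≡ there (∈-++⁺ˡ q)
           → (σ : Θ ↭ B ⊗ C ∷ (Γ ++ (Δ₁ ─ q)) ++ Δ₂)
           → cut A D (ten B C E₁ E₂ ρ) κ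
             ⟶ ten B C (cut A D (exch (extract₁ q) E₁) (↭-sym (shift B Γ (Δ₁ ─ q)))) E₂ σ
  c-ten-r₂ : ∀ {A B C Γ Δ Δ₁ Δ₂ Θ} {D : ⊢ A ∷ Γ} {E₁ : ⊢ B ∷ Δ₁} {E₂ : ⊢ C ∷ Δ₂}
               {ρ : A ᗮ ∷ Δ ↭ B ⊗ C ∷ Δ₁ ++ Δ₂} {κ : Θ ↭ Γ ++ Δ}
           → (q : A ᗮ ∈ Δ₂) → ∈-resp-↭ ρ (here ≡-refl) ≡ there (∈-++⁺ʳ Δ₁ q)
           → (σ : Θ ↭ B ⊗ C ∷ Δ₁ ++ Γ ++ (Δ₂ ─ q))
           → cut A D (ten B C E₁ E₂ ρ) κ
             ⟶ ten B C E₁ (cut A D (exch (extract₁ q) E₂) (↭-sym (shift C Γ (Δ₂ ─ q)))) σ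
  c-bot-r : ∀ {A Γ Δ Δ₀ Θ} {D : ⊢ A ∷ Γ} {E₀ : ⊢ Δ₀} {ρ : A ᗮ ∷ Δ ↭ ⊥ ∷ Δ₀}
              {κ : Θ ↭ Γ ++ Δ}
          → (q : A ᗮ ∈ Δ₀) → ∈-resp-↭ ρ (here ≡-refl) ≡ there q
          → (σ : Θ ↭ ⊥ ∷ Γ ++ (Δ₀ ─ q))
          → cut A D (bot E₀ ρ) κ ⟶ bot (cut A D (exch (extract q) E₀) refl) σ
  c-wk-r : ∀ {A B Γ Δ Δ₀ Θ} {D : ⊢ A ∷ Γ} {E₀ : ⊢ Δ₀} {ρ : A ᗮ ∷ Δ ↭ ¿ B ∷ Δ₀}
             {κ : Θ ↭ Γ ++ Δ}
         → (q : A ᗮ ∈ Δ₀) → ∈-resp-↭ ρ (here ≡-refl) ≡ there q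
         → (σ : Θ ↭ ¿ B ∷ Γ ++ (Δ₀ ─ q))
         → cut A D (wk B E₀ ρ) κ ⟶ wk B (cut A D (exch (extract q) E₀) refl) σ
  c-ab-r : ∀ {A B Γ Δ Δ₀ Θ} {D : ⊢ A ∷ Γ} {E₀ : ⊢ B ∷ ¿ B ∷ Δ₀} {ρ : A ᗮ ∷ Δ ↭ ¿ B ∷ Δ₀}
             {κ : Θ ↭ Γ ++ Δ}
         → (q : A ᗮ ∈ Δ₀) → ∈-resp-↭ ρ (here ≡-refl) ≡ there q
         → (σ : Θ ↭ ¿ B ∷ Γ ++ (Δ₀ ─ q))
         → cut A D (ab B E₀ ρ) κ
           ⟶ ab B (cut A D (exch (extract₂ q) E₀) (↭-sym (shift₂ B (¿ B) Γ (Δ₀ ─ q)))) σ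

  in-cut-l : ∀ {A Γ Δ Θ} {D D' : ⊢ A ∷ Γ} {E : ⊢ A ᗮ ∷ Δ} {κ : Θ ↭ Γ ++ Δ}
           → D ⟶ D' → cut A D E κ ⟶ cut A D' E κ
  in-cut-r : ∀ {A Γ Δ Θ} {D : ⊢ A ∷ Γ} {E E' : ⊢ A ᗮ ∷ Δ} {κ : Θ ↭ Γ ++ Δ}
           → E ⟶ E' → cut A D E κ ⟶ cut A D E' κ
  in-par   : ∀ {A B Γ Θ} {D D' : ⊢ A ∷ B ∷ Γ} {ρ : Θ ↭ A ⅋ B ∷ Γ}
           → D ⟶ D' → par A B D ρ ⟶ par A B D' ρ
  in-ten-l : ∀ {A B Γ Δ Θ} {D D' : ⊢ A ∷ Γ} {E : ⊢ B ∷ Δ} {ρ : Θ ↭ A ⊗ B ∷ Γ ++ Δ}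
           → D ⟶ D' → ten A B D E ρ ⟶ ten A B D' E ρ
  in-ten-r : ∀ {A B Γ Δ Θ} {D : ⊢ A ∷ Γ} {E E' : ⊢ B ∷ Δ} {ρ : Θ ↭ A ⊗ B ∷ Γ ++ Δ}
           → E ⟶ E' → ten A B D E ρ ⟶ ten A B D E' ρ
  in-bot   : ∀ {Γ Θ} {D D' : ⊢ Γ} {ρ : Θ ↭ ⊥ ∷ Γ}
           → D ⟶ D' → bot D ρ ⟶ bot D' ρ
  in-fp    : ∀ {A Γ Θ} {D D' : ⊢ A ∷ Γ} {ρ : Θ ↭ ! A ∷ ¿[ Γ ]}
           → D ⟶ D' → fp A D ρ ⟶ fp A D' ρ
  in-wk    : ∀ {A Γ Θ} {D D' : ⊢ Γ} {ρ : Θ ↭ ¿ A ∷ Γ}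
           → D ⟶ D' → wk A D ρ ⟶ wk A D' ρ
  in-ab    : ∀ {A Γ Θ} {D D' : ⊢ A ∷ ¿ A ∷ Γ} {ρ : Θ ↭ ¿ A ∷ Γ}
           → D ⟶ D' → ab A D ρ ⟶ ab A D' ρ

_⟶*_ : ∀ {Θ} → ⊢ Θ → ⊢ Θ → Set
_⟶*_ = Star _⟶_

-- It suffices to eliminate a single cut between two cut-free derivations D
-- and E, by induction on the degree of the cut formula and, inside it, on
-- size D + size E.  Looking at where the cut formula occurs in the last rules
-- of D and E: an axiom makes the cut disappear; an occurrence in a context
-- lets the cut commute upwards, decreasing the size; a principal pair leaves
-- at most cuts on immediate subformulas.  The exception is fp against ?b, whose
-- reduct keeps a cut on the same !B, but one against the premise of the
-- absorption, so of smaller size; the outer cut of that reduct is then on B.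

module Submission where

open import Defs
open import Function using (id)
open import Data.Empty using () renaming (⊥ to Empty)
open import Data.Unit using (tt)
open import Data.Product using (Σ; _×_; _,_)
open import Data.Nat using (ℕ; suc; _+_; _<_; _≤_; s≤s)
open import Data.Nat.Properties using (≤-refl; ≤-trans; ≤-reflexive; m≤m+n; m≤n+m; n<1+n; +-monoˡ-<; +-monoʳ-<)
open import Data.Nat.Induction using (<-wellFounded)
open import Induction.WellFounded using (Acc; acc)
open import Data.List using (List; []; _∷_; _++_)
open import Data.List.Properties using (map-++; ++-identityʳ)
open import Data.List.Relation.Unary.Any using (here; there)
open import Data.List.Membership.Propositional using (_∈_; _─_)
open import Data.List.Membership.Propositional.Properties using (∈-map⁺; ∈-++⁺ˡ; ∈-++⁺ʳ)
open import Data.List.Relation.Binary.Permutation.Propositional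
  using (_↭_; refl; prep; swap; trans; ↭-sym; ↭-reflexive)
open import Data.List.Relation.Binary.Permutation.Propositional.Properties
  using (∈-resp-↭; shift; shifts; ++-comm; ++-assoc; ++⁺ˡ; ++⁺ʳ; ++⁺; drop-∷)
open import Relation.Binary.PropositionalEquality using (_≡_; cong; cong₂; sym; subst) renaming (refl to ≡-refl)
open import Relation.Binary.Construct.Closure.ReflexiveTransitive using (ε; _◅_; _◅◅_; gmap)

variable
  A B C : Fm
  Γ Γ₀ Γ₁ Γ₂ Δ Δ₀ Θ Θ' : List Fm

ᗮ-involutive : ∀ A → A ᗮ ᗮ ≡ A
ᗮ-involutive (var x)  = ≡-refl
ᗮ-involutive (nvar x) = ≡-refl
ᗮ-involutive (A ⊗ B)  = cong₂ _⊗_ (ᗮ-involutive A) (ᗮ-involutive B)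
ᗮ-involutive (A ⅋ B)  = cong₂ _⅋_ (ᗮ-involutive A) (ᗮ-involutive B)
ᗮ-involutive (! A)    = cong !_ (ᗮ-involutive A)
ᗮ-involutive (¿ A)    = cong ¿_ (ᗮ-involutive A)
ᗮ-involutive 𝟏        = ≡-refl
ᗮ-involutive ⊥        = ≡-refl

degree : Fm → ℕ
degree (A ⊗ B) = suc (degree A + degree B)
degree (A ⅋ B) = suc (degree A + degree B)
degree (! A)   = suc (degree A)
degree (¿ A)   = suc (degree A)
degree _       = 1

size : ⊢ Θ → ℕ
size (ax A ρ)        = 1
size (cut A D E ρ)   = suc (size D + size E)
size (par A B D ρ)   = suc (size D)
size (ten A B D E ρ) = suc (size D + size E)
size (one ρ)         = 1
size (bot D ρ)       = suc (size D)
size (fp A D ρ)      = suc (size D)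
size (wk A D ρ)      = suc (size D)
size (ab A D ρ)      = suc (size D)

size-exch : (τ : Θ ↭ Θ') (D : ⊢ Θ) → size (exch τ D) ≡ size D
size-exch τ (ax A ρ)        = ≡-refl
size-exch τ (cut A D E ρ)   = ≡-refl
size-exch τ (par A B D ρ)   = ≡-refl
size-exch τ (ten A B D E ρ) = ≡-refl
size-exch τ (one ρ)         = ≡-refl
size-exch τ (bot D ρ)       = ≡-refl
size-exch τ (fp A D ρ)      = ≡-refl
size-exch τ (wk A D ρ)      = ≡-refl
size-exch τ (ab A D ρ)      = ≡-refl

exch-< : (τ : Θ ↭ Θ') (D : ⊢ Θ) {n : ℕ} → size D ≤ n → size (exch τ D) < suc n
exch-< τ D le = s≤s (≤-trans (≤-reflexive (size-exch τ D)) le)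

exch-cutFree : (τ : Θ ↭ Θ') (D : ⊢ Θ) → CutFree D → CutFree (exch τ D)
exch-cutFree τ (ax A ρ)        c = c
exch-cutFree τ (cut A D E ρ)   c = c
exch-cutFree τ (par A B D ρ)   c = c
exch-cutFree τ (ten A B D E ρ) c = c
exch-cutFree τ (one ρ)         c = c
exch-cutFree τ (bot D ρ)       c = c
exch-cutFree τ (fp A D ρ)      c = c
exch-cutFree τ (wk A D ρ)      c = c
exch-cutFree τ (ab A D ρ)      c = c

wks-cutFree : ∀ Γ (D : ⊢ Δ) → CutFree D → CutFree (wks Γ D)
wks-cutFree []      D c = c
wks-cutFree (G ∷ Γ) D c = wks-cutFree Γ D c

Normalisable : ⊢ Θ → Set
Normalisable {Θ} D = Σ (⊢ Θ) λ D' → CutFree D' × (D ⟶* D')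

normal : {D : ⊢ Θ} → CutFree D → Normalisable D
normal {D = D} c = D , c , ε

infixr 5 _◅-normalisable_

_◅-normalisable_ : {D D' : ⊢ Θ} → D ⟶ D' → Normalisable D' → Normalisable D
s ◅-normalisable (N , c , r) = N , c , s ◅ r

map-normalisable : (f : ⊢ Θ → ⊢ Θ') → (∀ {D D'} → D ⟶ D' → f D ⟶ f D')
                 → (∀ {D} → CutFree D → CutFree (f D))
                 → {D : ⊢ Θ} → Normalisable D → Normalisable (f D)
map-normalisable f f-⟶ f-cutFree (N , c , r) = f N , f-cutFree c , gmap f f-⟶ r

module _ {D : ⊢ A ∷ Γ} {E : ⊢ A ᗮ ∷ Δ} {κ : Θ ↭ Γ ++ Δ} where

  cut-normalisableˡ : Normalisable D
                    → (∀ D' → CutFree D' → Normalisable (cut A D' E κ))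
                    → Normalisable (cut A D E κ)
  cut-normalisableˡ (D' , c , r) k with k D' c
  ... | N , c' , r' = N , c' , gmap (λ X → cut A X E κ) in-cut-l r ◅◅ r'

  cut-normalisableʳ : Normalisable E
                    → (∀ E' → CutFree E' → Normalisable (cut A D E' κ))
                    → Normalisable (cut A D E κ)
  cut-normalisableʳ (E' , c , r) k with k E' c
  ... | N , c' , r' = N , c' , gmap (λ X → cut A D X κ) in-cut-r r ◅◅ r'

-- A cut under absorptions, normalisable whatever the exchange witness of its
-- conclusion: this invariant survives the exchanges performed by abs*.
AbsorbedCut : ⊢ Θ → Set
AbsorbedCut (cut {Γ} {Δ} A D E κ) = ∀ {Θ'} (κ' : Θ' ↭ Γ ++ Δ) → Normalisable (cut A D E κ')
AbsorbedCut (ab A D ρ)            = AbsorbedCut D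
AbsorbedCut _                     = Empty

exch-absorbedCut : (τ : Θ ↭ Θ') (D : ⊢ Θ) → AbsorbedCut D → AbsorbedCut (exch τ D)
exch-absorbedCut τ (cut A D E ρ) a = a
exch-absorbedCut τ (ab A D ρ)    a = a

abs*-absorbedCut : ∀ Γ {Δ} (D : ⊢ Γ ++ ¿[ Γ ] ++ Δ) → AbsorbedCut D → AbsorbedCut (abs* Γ {Δ} D)
abs*-absorbedCut []      D a = a
abs*-absorbedCut (G ∷ Γ) {Δ} D a =
  exch-absorbedCut _ (abs* Γ D')
    (abs*-absorbedCut Γ D' (exch-absorbedCut (prep G (shift (¿ G) Γ (¿[ Γ ] ++ Δ))) D a))
  where
  D' : ⊢ Γ ++ ¿[ Γ ] ++ ¿ G ∷ Δ
  D' = ab G (exch (prep G (shift (¿ G) Γ (¿[ Γ ] ++ Δ))) D) _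

absorbedCut-normalisable : (D : ⊢ Θ) → AbsorbedCut D → Normalisable D
absorbedCut-normalisable (cut A D E κ) a = a κ
absorbedCut-normalisable (ab A D ρ)    a =
  map-normalisable (λ X → ab A X ρ) in-ab id (absorbedCut-normalisable D a)

exch-abs*-normalisable : ∀ Γ {Δ} (D : ⊢ Γ ++ ¿[ Γ ] ++ Δ) (τ : ¿[ Γ ] ++ Δ ↭ Θ)
                       → AbsorbedCut D → Normalisable (exch τ (abs* Γ D))
exch-abs*-normalisable Γ D τ a =
  absorbedCut-normalisable (exch τ (abs* Γ D)) (exch-absorbedCut τ (abs* Γ D) (abs*-absorbedCut Γ D a))

frontImage : A ∷ Γ ↭ Γ₀ → A ∈ Γ₀
frontImage ρ = ∈-resp-↭ ρ (here ≡-refl)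

drop-at : A ∷ Γ ↭ Γ₀ → (p : A ∈ Γ₀) → Γ ↭ Γ₀ ─ p
drop-at ρ p = drop-∷ (trans ρ (extract p))

─-++ˡ : ∀ Γ₁ Γ₂ (q : A ∈ Γ₁) → (Γ₁ ++ Γ₂) ─ ∈-++⁺ˡ q ≡ (Γ₁ ─ q) ++ Γ₂
─-++ˡ (B ∷ Γ₁) Γ₂ (here e)  = ≡-refl
─-++ˡ (B ∷ Γ₁) Γ₂ (there q) = cong (B ∷_) (─-++ˡ Γ₁ Γ₂ q)

─-++ʳ : ∀ Γ₁ Γ₂ (q : A ∈ Γ₂) → (Γ₁ ++ Γ₂) ─ ∈-++⁺ʳ Γ₁ q ≡ Γ₁ ++ (Γ₂ ─ q)
─-++ʳ []       Γ₂ q = ≡-refl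
─-++ʳ (B ∷ Γ₁) Γ₂ q = cong (B ∷_) (─-++ʳ Γ₁ Γ₂ q)

─-map : ∀ Γ (q : A ∈ Γ) → ¿[ Γ ] ─ ∈-map⁺ ¿_ q ≡ ¿[ Γ ─ q ]
─-map (B ∷ Γ) (here ≡-refl) = ≡-refl
─-map (B ∷ Γ) (there q)     = cong (¿ B ∷_) (─-map Γ q)

data ++-View Γ₁ {Γ₂} : A ∈ Γ₁ ++ Γ₂ → Set where
  inˡ : (q : A ∈ Γ₁) → ++-View Γ₁ (∈-++⁺ˡ q)
  inʳ : (q : A ∈ Γ₂) → ++-View Γ₁ (∈-++⁺ʳ Γ₁ q)

++-view : ∀ Γ₁ (q : A ∈ Γ₁ ++ Γ₂) → ++-View Γ₁ q
++-view []       q         = inʳ q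
++-view (B ∷ Γ₁) (here e)  = inˡ (here e)
++-view (B ∷ Γ₁) (there q) with ++-view Γ₁ q
... | inˡ q₁ = inˡ (there q₁)
... | inʳ q₂ = inʳ q₂

data ¿-View Γ : A ∈ ¿[ Γ ] → Set where
  ¿-of : (q : B ∈ Γ) → ¿-View Γ (∈-map⁺ ¿_ q)

¿-view : ∀ Γ (q : A ∈ ¿[ Γ ]) → ¿-View Γ q
¿-view (B ∷ Γ) (here ≡-refl) = ¿-of (here ≡-refl)
¿-view (B ∷ Γ) (there q) with ¿-view Γ q
... | ¿-of q₀ = ¿-of (there q₀)

axiom-context : A ∷ Γ ↭ B ∷ B ᗮ ∷ [] → Γ ↭ A ᗮ ∷ []
axiom-context {A} {Γ} {B} ρ with frontImage ρ
... | here ≡-refl         = drop-∷ ρ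
... | there (here ≡-refl) =
  subst (λ X → Γ ↭ X ∷ []) (sym (ᗮ-involutive B)) (drop-at ρ (there (here ≡-refl)))

++-swapʳ : ∀ (Γ Δ₁ Δ₂ : List Fm) → (Γ ++ Δ₁) ++ Δ₂ ↭ (Γ ++ Δ₂) ++ Δ₁
++-swapʳ Γ Δ₁ Δ₂ =
  trans (++-assoc Γ Δ₁ Δ₂) (trans (++⁺ˡ Γ (++-comm Δ₁ Δ₂)) (↭-sym (++-assoc Γ Δ₂ Δ₁)))

passiveˡ-↭ : {P : Fm} → Θ ↭ Γ ++ Δ → A ∷ Γ ↭ P ∷ Γ₀ → (q : A ∈ Γ₀) → Θ ↭ P ∷ (Γ₀ ─ q) ++ Δ
passiveˡ-↭ {Δ = Δ} κ ρ q = trans κ (++⁺ʳ Δ (drop-at ρ (there q)))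

passiveʳ-↭ : {P : Fm} → Θ ↭ Γ ++ Δ → A ∷ Δ ↭ P ∷ Δ₀ → (q : A ∈ Δ₀) → Θ ↭ P ∷ Γ ++ (Δ₀ ─ q)
passiveʳ-↭ {Γ = Γ} {Δ₀ = Δ₀} {P = P} κ ρ q =
  trans κ (trans (++⁺ˡ Γ (drop-at ρ (there q))) (shift P Γ (Δ₀ ─ q)))

promoted-context : ¿ B ∷ Γ ↭ ! C ∷ ¿[ Δ₀ ] → (q : B ∈ Δ₀) → Γ ↭ ! C ∷ ¿[ Δ₀ ─ q ]
promoted-context {Γ = Γ} {C = C} {Δ₀ = Δ₀} ρ q =
  subst (λ X → Γ ↭ ! C ∷ X) (─-map Δ₀ q) (drop-at ρ (there (∈-map⁺ ¿_ q)))

data Passive : ⊢ A ∷ Γ → Set where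
  par-ctx  : {D₀ : ⊢ B ∷ C ∷ Γ₀} {ρ : A ∷ Γ ↭ B ⅋ C ∷ Γ₀}
           (q : A ∈ Γ₀) → frontImage ρ ≡ there q → Passive (par B C D₀ ρ)
  ten-ctx₁ : {D₁ : ⊢ B ∷ Γ₁} {D₂ : ⊢ C ∷ Γ₂} {ρ : A ∷ Γ ↭ B ⊗ C ∷ Γ₁ ++ Γ₂}
           (q : A ∈ Γ₁) → frontImage ρ ≡ there (∈-++⁺ˡ q) → Passive (ten B C D₁ D₂ ρ)
  ten-ctx₂ : {D₁ : ⊢ B ∷ Γ₁} {D₂ : ⊢ C ∷ Γ₂} {ρ : A ∷ Γ ↭ B ⊗ C ∷ Γ₁ ++ Γ₂}
           (q : A ∈ Γ₂) → frontImage ρ ≡ there (∈-++⁺ʳ Γ₁ q) → Passive (ten B C D₁ D₂ ρ)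
  bot-ctx  : {D₀ : ⊢ Γ₀} {ρ : A ∷ Γ ↭ ⊥ ∷ Γ₀}
           (q : A ∈ Γ₀) → frontImage ρ ≡ there q → Passive (bot D₀ ρ)
  wk-ctx   : {D₀ : ⊢ Γ₀} {ρ : A ∷ Γ ↭ ¿ B ∷ Γ₀}
           (q : A ∈ Γ₀) → frontImage ρ ≡ there q → Passive (wk B D₀ ρ)
  ab-ctx   : {D₀ : ⊢ B ∷ ¿ B ∷ Γ₀} {ρ : A ∷ Γ ↭ ¿ B ∷ Γ₀}
           (q : A ∈ Γ₀) → frontImage ρ ≡ there q → Passive (ab B D₀ ρ)

-- A ?B in the context of a promotion is not passive: no commutative step
-- crosses fp, so such a cut is only reduced against a promotion of !B^⊥.
data FrontView : ⊢ A ∷ Γ → Set where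
  axiom    : {ρ : A ∷ Γ ↭ B ∷ B ᗮ ∷ []} → FrontView (ax B ρ)
  passive  : {D : ⊢ A ∷ Γ} → Passive D → FrontView D
  fp-ctx   : {D₀ : ⊢ C ∷ Γ₀} {ρ : ¿ B ∷ Γ ↭ ! C ∷ ¿[ Γ₀ ]}
           (q : B ∈ Γ₀) → frontImage ρ ≡ there (∈-map⁺ ¿_ q) → FrontView (fp C D₀ ρ)
  par-head : {D₀ : ⊢ B ∷ C ∷ Γ₀} {ρ : B ⅋ C ∷ Γ ↭ B ⅋ C ∷ Γ₀} → Hd ρ → FrontView (par B C D₀ ρ)
  ten-head : {D₁ : ⊢ B ∷ Γ₁} {D₂ : ⊢ C ∷ Γ₂} {ρ : B ⊗ C ∷ Γ ↭ B ⊗ C ∷ Γ₁ ++ Γ₂}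
           → Hd ρ → FrontView (ten B C D₁ D₂ ρ)
  one-head : {ρ : 𝟏 ∷ Γ ↭ 𝟏 ∷ []} → FrontView (one ρ)
  bot-head : {D₀ : ⊢ Γ₀} {ρ : ⊥ ∷ Γ ↭ ⊥ ∷ Γ₀} → Hd ρ → FrontView (bot D₀ ρ)
  fp-head  : {D₀ : ⊢ B ∷ Γ₀} {ρ : ! B ∷ Γ ↭ ! B ∷ ¿[ Γ₀ ]} → Hd ρ → FrontView (fp B D₀ ρ)
  wk-head  : {D₀ : ⊢ Γ₀} {ρ : ¿ B ∷ Γ ↭ ¿ B ∷ Γ₀} → Hd ρ → FrontView (wk B D₀ ρ)
  ab-head  : {D₀ : ⊢ B ∷ ¿ B ∷ Γ₀} {ρ : ¿ B ∷ Γ ↭ ¿ B ∷ Γ₀} → Hd ρ → FrontView (ab B D₀ ρ)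

frontView : (D : ⊢ A ∷ Γ) → CutFree D → FrontView D
frontView (ax B ρ) _ = axiom
frontView (par B C D ρ) _ with frontImage ρ in eq
... | here ≡-refl = par-head eq
... | there q     = passive (par-ctx q eq)
frontView (ten {Γ₁} B C D E ρ) _ with frontImage ρ in eq
... | here ≡-refl = ten-head eq
... | there q with ++-view Γ₁ q
...   | inˡ q₁ = passive (ten-ctx₁ q₁ eq)
...   | inʳ q₂ = passive (ten-ctx₂ q₂ eq)
frontView (one ρ) _ with frontImage ρ
... | here ≡-refl = one-head
frontView (bot D ρ) _ with frontImage ρ in eq
... | here ≡-refl = bot-head eq
... | there q     = passive (bot-ctx q eq)
frontView (fp {Γ₀} B D ρ) _ with frontImage ρ in eq
... | here ≡-refl = fp-head eq
... | there q with ¿-view Γ₀ q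
...   | ¿-of q₀ = fp-ctx q₀ eq
frontView (wk B D ρ) _ with frontImage ρ in eq
... | here ≡-refl = wk-head eq
... | there q     = passive (wk-ctx q eq)
frontView (ab B D ρ) _ with frontImage ρ in eq
... | here ≡-refl = ab-head eq
... | there q     = passive (ab-ctx q eq)

CutNormalises : ⊢ A ∷ Γ → ⊢ A ᗮ ∷ Δ → Set
CutNormalises {A} {Γ} {Δ} D E = ∀ {Θ} (κ : Θ ↭ Γ ++ Δ) → Normalisable (cut A D E κ)

CutsBelow : ℕ → Set
CutsBelow n = ∀ {A Γ Δ} (D : ⊢ A ∷ Γ) (E : ⊢ A ᗮ ∷ Δ)
            → degree A < n → CutFree D → CutFree E → CutNormalises D E

CutsOn : Fm → ℕ → Set
CutsOn A n = ∀ {Γ Δ} (D : ⊢ A ∷ Γ) (E : ⊢ A ᗮ ∷ Δ)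
           → size D + size E < n → CutFree D → CutFree E → CutNormalises D E

ax-cutˡ : {ρ : A ∷ Γ ↭ B ∷ B ᗮ ∷ []} (E : ⊢ A ᗮ ∷ Δ) → CutFree E → CutNormalises (ax B ρ) E
ax-cutˡ {A} {Γ} {Δ = Δ} {ρ} E cE {Θ} κ = ax-l σ ◅-normalisable normal (exch-cutFree σ E cE)
  where
  σ : A ᗮ ∷ Δ ↭ Θ
  σ = ↭-sym (trans κ (++⁺ʳ Δ (axiom-context ρ)))

ax-cutʳ : (D : ⊢ A ∷ Γ) → CutFree D → {ρ : A ᗮ ∷ Δ ↭ B ∷ B ᗮ ∷ []} → CutNormalises D (ax B ρ)
ax-cutʳ {A} {Γ} {Δ} D cD {ρ} {Θ} κ = ax-r σ ◅-normalisable normal (exch-cutFree σ D cD)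
  where
  Δ↭A : Δ ↭ A ∷ []
  Δ↭A = subst (λ X → Δ ↭ X ∷ []) (ᗮ-involutive A) (axiom-context ρ)
  σ : A ∷ Γ ↭ Θ
  σ = ↭-sym (trans κ (trans (++⁺ˡ Γ Δ↭A) (++-comm Γ (A ∷ []))))

module _ {n : ℕ} where

  smaller-cutˡ : (E : ⊢ A ᗮ ∷ Δ) → CutsOn A (suc n + size E)
               → (τ : Θ ↭ A ∷ Γ) (D : ⊢ Θ) → size D ≤ n → CutFree D → CutFree E
               → CutNormalises (exch τ D) E
  smaller-cutˡ E on τ D le cD cE =
    on (exch τ D) E (+-monoˡ-< (size E) (exch-< τ D le)) (exch-cutFree τ D cD) cE

  smaller-cutʳ : (D : ⊢ A ∷ Γ) → CutsOn A (size D + suc n)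
               → (τ : Θ ↭ A ᗮ ∷ Δ) (E : ⊢ Θ) → size E ≤ n → CutFree D → CutFree E
               → CutNormalises D (exch τ E)
  smaller-cutʳ D on τ E le cD cE =
    on D (exch τ E) (+-monoʳ-< (size D) (exch-< τ E le)) cD (exch-cutFree τ E cE)

commute-cutˡ : {D : ⊢ A ∷ Γ} (E : ⊢ A ᗮ ∷ Δ) → CutsOn A (size D + size E)
             → CutFree D → CutFree E → Passive D → CutNormalises D E
commute-cutˡ E on cD cE (par-ctx {B = B} {C = C} {D₀ = D₀} {ρ = ρ} q eq) κ =
  c-par-l q eq σ ◅-normalisable map-normalisable (λ X → par B C X σ) in-par id
    (smaller-cutˡ E on (extract₂ q) D₀ ≤-refl cD cE refl)
  where σ = passiveˡ-↭ κ ρ q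
commute-cutˡ E on cD cE (bot-ctx {D₀ = D₀} {ρ = ρ} q eq) κ =
  c-bot-l q eq σ ◅-normalisable map-normalisable (λ X → bot X σ) in-bot id
    (smaller-cutˡ E on (extract q) D₀ ≤-refl cD cE refl)
  where σ = passiveˡ-↭ κ ρ q
commute-cutˡ E on cD cE (wk-ctx {B = B} {D₀ = D₀} {ρ = ρ} q eq) κ =
  c-wk-l q eq σ ◅-normalisable map-normalisable (λ X → wk B X σ) in-wk id
    (smaller-cutˡ E on (extract q) D₀ ≤-refl cD cE refl)
  where σ = passiveˡ-↭ κ ρ q
commute-cutˡ E on cD cE (ab-ctx {B = B} {D₀ = D₀} {ρ = ρ} q eq) κ =
  c-ab-l q eq σ ◅-normalisable map-normalisable (λ X → ab B X σ) in-ab id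
    (smaller-cutˡ E on (extract₂ q) D₀ ≤-refl cD cE refl)
  where σ = passiveˡ-↭ κ ρ q
commute-cutˡ {Δ = Δ} E on (cD₁ , cD₂) cE
  (ten-ctx₁ {B = B} {Γ₁ = Γ₁} {C = C} {Γ₂ = Γ₂} {D₁ = D₁} {D₂ = D₂} {ρ = ρ} q eq) κ =
  c-ten-l₁ q eq σ ◅-normalisable map-normalisable (λ X → ten B C X D₂ σ) in-ten-l (_, cD₂)
    (smaller-cutˡ E on (extract₁ q) D₁ (m≤m+n _ _) cD₁ cE refl)
  where
  σ = trans (passiveˡ-↭ κ ρ (∈-++⁺ˡ q))
        (prep (B ⊗ C) (trans (↭-reflexive (cong (_++ Δ) (─-++ˡ Γ₁ Γ₂ q))) (++-swapʳ (Γ₁ ─ q) Γ₂ Δ)))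
commute-cutˡ {Δ = Δ} E on (cD₁ , cD₂) cE
  (ten-ctx₂ {B = B} {Γ₁ = Γ₁} {C = C} {Γ₂ = Γ₂} {D₁ = D₁} {D₂ = D₂} {ρ = ρ} q eq) κ =
  c-ten-l₂ q eq σ ◅-normalisable map-normalisable (λ X → ten B C D₁ X σ) in-ten-r (cD₁ ,_)
    (smaller-cutˡ E on (extract₁ q) D₂ (m≤n+m _ _) cD₂ cE refl)
  where
  σ = trans (passiveˡ-↭ κ ρ (∈-++⁺ʳ Γ₁ q))
        (prep (B ⊗ C) (trans (↭-reflexive (cong (_++ Δ) (─-++ʳ Γ₁ Γ₂ q))) (++-assoc Γ₁ (Γ₂ ─ q) Δ)))

commute-cutʳ : (D : ⊢ A ∷ Γ) {E : ⊢ A ᗮ ∷ Δ} → CutsOn A (size D + size E)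
             → CutFree D → CutFree E → Passive E → CutNormalises D E
commute-cutʳ {Γ = Γ} D on cD cE (par-ctx {B = B} {C = C} {Γ₀ = Δ₀} {D₀ = E₀} {ρ = ρ} q eq) κ =
  c-par-r q eq σ ◅-normalisable map-normalisable (λ X → par B C X σ) in-par id
    (smaller-cutʳ D on (extract₂ q) E₀ ≤-refl cD cE (↭-sym (shift₂ B C Γ (Δ₀ ─ q))))
  where σ = passiveʳ-↭ κ ρ q
commute-cutʳ D on cD cE (bot-ctx {D₀ = E₀} {ρ = ρ} q eq) κ =
  c-bot-r q eq σ ◅-normalisable map-normalisable (λ X → bot X σ) in-bot id
    (smaller-cutʳ D on (extract q) E₀ ≤-refl cD cE refl)
  where σ = passiveʳ-↭ κ ρ q
commute-cutʳ D on cD cE (wk-ctx {B = B} {D₀ = E₀} {ρ = ρ} q eq) κ =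
  c-wk-r q eq σ ◅-normalisable map-normalisable (λ X → wk B X σ) in-wk id
    (smaller-cutʳ D on (extract q) E₀ ≤-refl cD cE refl)
  where σ = passiveʳ-↭ κ ρ q
commute-cutʳ {Γ = Γ} D on cD cE (ab-ctx {B = B} {Γ₀ = Δ₀} {D₀ = E₀} {ρ = ρ} q eq) κ =
  c-ab-r q eq σ ◅-normalisable map-normalisable (λ X → ab B X σ) in-ab id
    (smaller-cutʳ D on (extract₂ q) E₀ ≤-refl cD cE (↭-sym (shift₂ B (¿ B) Γ (Δ₀ ─ q))))
  where σ = passiveʳ-↭ κ ρ q
commute-cutʳ {Γ = Γ} D on cD (cE₁ , cE₂)
  (ten-ctx₁ {B = B} {Γ₁ = Δ₁} {C = C} {Γ₂ = Δ₂} {D₁ = E₁} {D₂ = E₂} {ρ = ρ} q eq) κ =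
  c-ten-r₁ q eq σ ◅-normalisable map-normalisable (λ X → ten B C X E₂ σ) in-ten-l (_, cE₂)
    (smaller-cutʳ D on (extract₁ q) E₁ (m≤m+n _ _) cD cE₁ (↭-sym (shift B Γ (Δ₁ ─ q))))
  where
  σ = trans (passiveʳ-↭ κ ρ (∈-++⁺ˡ q))
        (prep (B ⊗ C) (trans (↭-reflexive (cong (Γ ++_) (─-++ˡ Δ₁ Δ₂ q)))
                             (↭-sym (++-assoc Γ (Δ₁ ─ q) Δ₂))))
commute-cutʳ {Γ = Γ} D on cD (cE₁ , cE₂)
  (ten-ctx₂ {B = B} {Γ₁ = Δ₁} {C = C} {Γ₂ = Δ₂} {D₁ = E₁} {D₂ = E₂} {ρ = ρ} q eq) κ =
  c-ten-r₂ q eq σ ◅-normalisable map-normalisable (λ X → ten B C E₁ X σ) in-ten-r (cE₁ ,_)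
    (smaller-cutʳ D on (extract₁ q) E₂ (m≤n+m _ _) cD cE₂ (↭-sym (shift C Γ (Δ₂ ─ q))))
  where
  σ = trans (passiveʳ-↭ κ ρ (∈-++⁺ʳ Δ₁ q))
        (prep (B ⊗ C) (trans (↭-reflexive (cong (Γ ++_) (─-++ʳ Δ₁ Δ₂ q))) (shifts Γ Δ₁)))

par-ten-cut : ∀ {B C Γ Γ₀ Δ Δ₁ Δ₂} {D₀ : ⊢ B ∷ C ∷ Γ₀} {ρ : B ⅋ C ∷ Γ ↭ B ⅋ C ∷ Γ₀}
                {E₁ : ⊢ B ᗮ ∷ Δ₁} {E₂ : ⊢ C ᗮ ∷ Δ₂} {ρ' : B ᗮ ⊗ C ᗮ ∷ Δ ↭ B ᗮ ⊗ C ᗮ ∷ Δ₁ ++ Δ₂}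
            → CutsBelow (degree (B ⅋ C)) → Hd ρ → Hd ρ' → CutFree D₀ → CutFree E₁ × CutFree E₂
            → CutNormalises (par B C D₀ ρ) (ten (B ᗮ) (C ᗮ) E₁ E₂ ρ')
par-ten-cut {Γ₀ = Γ₀} {Δ₁ = Δ₁} {Δ₂} {D₀} {ρ} {E₁} {E₂} {ρ'} below hd hd' cD (cE₁ , cE₂) κ =
  par-ten hd hd' σ ◅-normalisable
    cut-normalisableˡ (below D₀ E₁ (s≤s (m≤m+n _ _)) cD cE₁ refl)
      λ F cF → below F E₂ (s≤s (m≤n+m _ _)) cF cE₂ σ
  where
  σ = trans κ (trans (++⁺ (drop-∷ ρ) (drop-∷ ρ')) (↭-sym (++-assoc Γ₀ Δ₁ Δ₂)))

ten-par-cut : ∀ {B C Γ Γ₁ Γ₂ Δ Δ₀} {D₁ : ⊢ B ∷ Γ₁} {D₂ : ⊢ C ∷ Γ₂}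
                {ρ : B ⊗ C ∷ Γ ↭ B ⊗ C ∷ Γ₁ ++ Γ₂} {E₀ : ⊢ B ᗮ ∷ C ᗮ ∷ Δ₀} {ρ' : B ᗮ ⅋ C ᗮ ∷ Δ ↭ B ᗮ ⅋ C ᗮ ∷ Δ₀}
            → CutsBelow (degree (B ⊗ C)) → Hd ρ → Hd ρ' → CutFree D₁ × CutFree D₂ → CutFree E₀
            → CutNormalises (ten B C D₁ D₂ ρ) (par (B ᗮ) (C ᗮ) E₀ ρ')
ten-par-cut {C = C} {Γ₁ = Γ₁} {Γ₂} {Δ₀ = Δ₀} {D₁} {D₂} {ρ} {E₀} {ρ'} below hd hd' (cD₁ , cD₂) cE κ =
  ten-par hd hd' σ ◅-normalisable
    cut-normalisableʳ (below D₁ E₀ (s≤s (m≤m+n _ _)) cD₁ cE (↭-sym (shift (C ᗮ) Γ₁ Δ₀)))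
      λ F cF → below D₂ F (s≤s (m≤n+m _ _)) cD₂ cF σ
  where
  σ = trans κ (trans (++⁺ (trans (drop-∷ ρ) (++-comm Γ₁ Γ₂)) (drop-∷ ρ')) (++-assoc Γ₂ Γ₁ Δ₀))

bot-one-cut : ∀ {Γ Γ₀ Δ} {D₀ : ⊢ Γ₀} {ρ : ⊥ ∷ Γ ↭ ⊥ ∷ Γ₀} {ρ' : 𝟏 ∷ Δ ↭ 𝟏 ∷ []}
            → Hd ρ → CutFree D₀ → CutNormalises (bot D₀ ρ) (one ρ')
bot-one-cut {Γ₀ = Γ₀} {D₀ = D₀} {ρ} {ρ'} hd cD κ =
  bot-one hd σ ◅-normalisable normal (exch-cutFree σ D₀ cD)
  where σ = ↭-sym (trans κ (trans (++⁺ (drop-∷ ρ) (drop-∷ ρ')) (↭-reflexive (++-identityʳ Γ₀))))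

one-bot-cut : ∀ {Γ Δ Δ₀} {ρ : 𝟏 ∷ Γ ↭ 𝟏 ∷ []} {E₀ : ⊢ Δ₀} {ρ' : ⊥ ∷ Δ ↭ ⊥ ∷ Δ₀}
            → Hd ρ' → CutFree E₀ → CutNormalises (one ρ) (bot E₀ ρ')
one-bot-cut {ρ = ρ} {E₀} {ρ'} hd' cE κ =
  one-bot hd' σ ◅-normalisable normal (exch-cutFree σ E₀ cE)
  where σ = ↭-sym (trans κ (++⁺ (drop-∷ ρ) (drop-∷ ρ')))

fp-fp-cut : ∀ {B C Γ Γ₀ Δ Δ₀} {D₀ : ⊢ B ∷ Γ₀} {ρ : ! B ∷ Γ ↭ ! B ∷ ¿[ Γ₀ ]}
              {E₀ : ⊢ C ∷ Δ₀} {ρ' : ¿ (B ᗮ) ∷ Δ ↭ ! C ∷ ¿[ Δ₀ ]}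
          → CutsBelow (degree (! B)) → Hd ρ → (q : B ᗮ ∈ Δ₀) → frontImage ρ' ≡ there (∈-map⁺ ¿_ q)
          → CutFree D₀ → CutFree E₀ → CutNormalises (fp B D₀ ρ) (fp C E₀ ρ')
fp-fp-cut {C = C} {Γ₀ = Γ₀} {Δ₀ = Δ₀} {D₀} {ρ} {E₀} {ρ'} below hd q eq cD cE κ =
  fp-fp hd q eq σ ◅-normalisable map-normalisable (λ X → fp C X σ) in-fp id
    (below D₀ (exch (extract₁ q) E₀) (n<1+n _) cD (exch-cutFree _ E₀ cE) (↭-sym (shift C Γ₀ (Δ₀ ─ q))))
  where
  σ = trans κ (trans (++⁺ (drop-∷ ρ) (promoted-context ρ' q))
        (trans (shift (! C) ¿[ Γ₀ ] ¿[ Δ₀ ─ q ])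
               (prep (! C) (↭-reflexive (sym (map-++ ¿_ Γ₀ (Δ₀ ─ q)))))))

fp-fp′-cut : ∀ {B C Γ Γ₀ Δ Δ₀} {D₀ : ⊢ C ∷ Γ₀} {ρ : ¿ B ∷ Γ ↭ ! C ∷ ¿[ Γ₀ ]}
               {E₀ : ⊢ B ᗮ ∷ Δ₀} {ρ' : ! (B ᗮ) ∷ Δ ↭ ! (B ᗮ) ∷ ¿[ Δ₀ ]}
           → CutsBelow (degree (¿ B)) → (q : B ∈ Γ₀) → frontImage ρ ≡ there (∈-map⁺ ¿_ q) → Hd ρ'
           → CutFree D₀ → CutFree E₀ → CutNormalises (fp C D₀ ρ) (fp (B ᗮ) E₀ ρ')
fp-fp′-cut {C = C} {Γ₀ = Γ₀} {Δ₀ = Δ₀} {D₀} {ρ} {E₀} {ρ'} below q eq hd' cD cE κ =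
  fp-fp' hd' q eq σ ◅-normalisable map-normalisable (λ X → fp C X σ) in-fp id
    (below (exch (extract₁ q) D₀) E₀ (n<1+n _) (exch-cutFree _ D₀ cD) cE refl)
  where
  σ = trans κ (trans (++⁺ (promoted-context ρ q) (drop-∷ ρ'))
        (prep (! C) (↭-reflexive (sym (map-++ ¿_ (Γ₀ ─ q) Δ₀)))))

fp-wk-cut : ∀ {B Γ Γ₀ Δ Δ₀} {D₀ : ⊢ B ∷ Γ₀} {ρ : ! B ∷ Γ ↭ ! B ∷ ¿[ Γ₀ ]}
              {E₀ : ⊢ Δ₀} {ρ' : ¿ (B ᗮ) ∷ Δ ↭ ¿ (B ᗮ) ∷ Δ₀}
          → Hd ρ → Hd ρ' → CutFree E₀ → CutNormalises (fp B D₀ ρ) (wk (B ᗮ) E₀ ρ')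
fp-wk-cut {Γ₀ = Γ₀} {ρ = ρ} {E₀} {ρ'} hd hd' cE κ =
  fp-wk hd hd' σ ◅-normalisable normal (exch-cutFree σ (wks Γ₀ E₀) (wks-cutFree Γ₀ E₀ cE))
  where σ = ↭-sym (trans κ (++⁺ (drop-∷ ρ) (drop-∷ ρ')))

wk-fp-cut : ∀ {B Γ Γ₀ Δ Δ₀} {D₀ : ⊢ Γ₀} {ρ : ¿ B ∷ Γ ↭ ¿ B ∷ Γ₀}
              {E₀ : ⊢ B ᗮ ∷ Δ₀} {ρ' : ! (B ᗮ) ∷ Δ ↭ ! (B ᗮ) ∷ ¿[ Δ₀ ]}
          → Hd ρ → Hd ρ' → CutFree D₀ → CutNormalises (wk B D₀ ρ) (fp (B ᗮ) E₀ ρ')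
wk-fp-cut {Γ₀ = Γ₀} {Δ₀ = Δ₀} {D₀} {ρ} {ρ' = ρ'} hd hd' cD κ =
  wk-fp hd' hd σ ◅-normalisable normal (exch-cutFree σ (wks Δ₀ D₀) (wks-cutFree Δ₀ D₀ cD))
  where σ = ↭-sym (trans κ (trans (++⁺ (drop-∷ ρ) (drop-∷ ρ')) (++-comm Γ₀ ¿[ Δ₀ ])))

fp-ab-cut : ∀ {B Γ Γ₀ Δ Δ₀} {D₀ : ⊢ B ∷ Γ₀} {ρ : ! B ∷ Γ ↭ ! B ∷ ¿[ Γ₀ ]}
              {E₀ : ⊢ B ᗮ ∷ ¿ (B ᗮ) ∷ Δ₀} {ρ' : ¿ (B ᗮ) ∷ Δ ↭ ¿ (B ᗮ) ∷ Δ₀}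
          → CutsBelow (degree (! B)) → CutsOn (! B) (size (fp B D₀ ρ) + size (ab (B ᗮ) E₀ ρ'))
          → Hd ρ → Hd ρ' → CutFree D₀ → CutFree E₀ → CutNormalises (fp B D₀ ρ) (ab (B ᗮ) E₀ ρ')
fp-ab-cut {B} {Γ₀ = Γ₀} {Δ₀ = Δ₀} {D₀} {ρ} {E₀} {ρ'} below on hd hd' cD cE κ =
  fp-ab hd hd' σ ◅-normalisable
    exch-abs*-normalisable Γ₀ (cut B D₀ inner refl) σ outer
  where
  σ = ↭-sym (trans κ (++⁺ (drop-∷ ρ) (drop-∷ ρ')))
  inner : ⊢ B ᗮ ∷ ¿[ Γ₀ ] ++ Δ₀
  inner = cut (! B) (fp B D₀ refl) (exch (swap (B ᗮ) (¿ (B ᗮ)) refl) E₀)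
              (↭-sym (shift (B ᗮ) ¿[ Γ₀ ] Δ₀))
  outer : CutNormalises D₀ inner
  outer κ' = cut-normalisableʳ
    (smaller-cutʳ (fp B D₀ refl) on (swap (B ᗮ) (¿ (B ᗮ)) refl) E₀ ≤-refl cD cE _)
    λ F cF → below D₀ F (n<1+n _) cD cF κ'

ab-fp-cut : ∀ {B Γ Γ₀ Δ Δ₀} {D₀ : ⊢ B ∷ ¿ B ∷ Γ₀} {ρ : ¿ B ∷ Γ ↭ ¿ B ∷ Γ₀}
              {E₀ : ⊢ B ᗮ ∷ Δ₀} {ρ' : ! (B ᗮ) ∷ Δ ↭ ! (B ᗮ) ∷ ¿[ Δ₀ ]}
          → CutsBelow (degree (¿ B)) → CutsOn (¿ B) (size (ab B D₀ ρ) + size (fp (B ᗮ) E₀ ρ'))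
          → Hd ρ → Hd ρ' → CutFree D₀ → CutFree E₀ → CutNormalises (ab B D₀ ρ) (fp (B ᗮ) E₀ ρ')
ab-fp-cut {B} {Γ₀ = Γ₀} {Δ₀ = Δ₀} {D₀} {ρ} {E₀} {ρ'} below on hd hd' cD cE κ =
  ab-fp hd' hd σ ◅-normalisable
    exch-abs*-normalisable Δ₀ (cut B inner E₀ κ₀) σ outer
  where
  σ = ↭-sym (trans κ (trans (++⁺ (drop-∷ ρ) (drop-∷ ρ')) (++-comm Γ₀ ¿[ Δ₀ ])))
  κ₀ = trans (++⁺ˡ Δ₀ (++-comm ¿[ Δ₀ ] Γ₀)) (++-comm Δ₀ (Γ₀ ++ ¿[ Δ₀ ]))
  inner : ⊢ B ∷ Γ₀ ++ ¿[ Δ₀ ]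
  inner = cut (¿ B) (exch (swap B (¿ B) refl) D₀) (fp (B ᗮ) E₀ refl) refl
  outer : CutNormalises inner E₀
  outer κ' = cut-normalisableˡ
    (smaller-cutˡ (fp (B ᗮ) E₀ refl) on (swap B (¿ B) refl) D₀ ≤-refl cD cE refl)
    λ F cF → below F E₀ (n<1+n _) cF cE κ'

cut-by-views : (D : ⊢ A ∷ Γ) (E : ⊢ A ᗮ ∷ Δ)
             → CutsBelow (degree A) → CutsOn A (size D + size E)
             → CutFree D → CutFree E → FrontView D → FrontView E → CutNormalises D E
cut-by-views D E below on cD cE axiom         _             = ax-cutˡ E cE
cut-by-views D E below on cD cE (passive p)   _             = commute-cutˡ E on cD cE p
cut-by-views D E below on cD cE _             axiom         = ax-cutʳ D cD
cut-by-views D E below on cD cE _             (passive p)   = commute-cutʳ D on cD cE p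
cut-by-views D E below on cD cE (par-head hd) (ten-head hd') = par-ten-cut below hd hd' cD cE
cut-by-views D E below on cD cE (ten-head hd) (par-head hd') = ten-par-cut below hd hd' cD cE
cut-by-views D E below on cD cE (bot-head hd) one-head       = bot-one-cut hd cD
cut-by-views D E below on cD cE one-head      (bot-head hd') = one-bot-cut hd' cE
cut-by-views D E below on cD cE (fp-head hd)  (fp-ctx q eq)  = fp-fp-cut below hd q eq cD cE
cut-by-views D E below on cD cE (fp-ctx q eq) (fp-head hd')  = fp-fp′-cut below q eq hd' cD cE
cut-by-views D E below on cD cE (fp-head hd)  (wk-head hd')  = fp-wk-cut hd hd' cE
cut-by-views D E below on cD cE (wk-head hd)  (fp-head hd')  = wk-fp-cut hd hd' cD
cut-by-views D E below on cD cE (fp-head hd)  (ab-head hd')  = fp-ab-cut below on hd hd' cD cE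
cut-by-views D E below on cD cE (ab-head hd)  (fp-head hd')  = ab-fp-cut below on hd hd' cD cE

cutFree-cut-normalises-acc : (D : ⊢ A ∷ Γ) (E : ⊢ A ᗮ ∷ Δ)
                           → Acc _<_ (degree A) → Acc _<_ (size D + size E)
                           → CutFree D → CutFree E → CutNormalises D E
cutFree-cut-normalises-acc D E degree-acc@(acc smaller-degree) (acc smaller-size) cD cE =
  cut-by-views D E
    (λ D' E' lt → cutFree-cut-normalises-acc D' E' (smaller-degree lt) (<-wellFounded _))
    (λ D' E' lt → cutFree-cut-normalises-acc D' E' degree-acc (smaller-size lt))
    cD cE (frontView D cD) (frontView E cE)

cutFree-cut-normalises : (D : ⊢ A ∷ Γ) (E : ⊢ A ᗮ ∷ Δ) → CutFree D → CutFree E → CutNormalises D E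
cutFree-cut-normalises D E = cutFree-cut-normalises-acc D E (<-wellFounded _) (<-wellFounded _)

theorem3p3 : ∀ {Θ : List Fm} (D : ⊢ Θ) → Σ (⊢ Θ) (λ D' → CutFree D' × (D ⟶* D'))
theorem3p3 (ax A ρ)      = normal tt
theorem3p3 (one ρ)       = normal tt
theorem3p3 (par A B D ρ) = map-normalisable (λ X → par A B X ρ) in-par id (theorem3p3 D)
theorem3p3 (bot D ρ)     = map-normalisable (λ X → bot X ρ) in-bot id (theorem3p3 D)
theorem3p3 (fp A D ρ)    = map-normalisable (λ X → fp A X ρ) in-fp id (theorem3p3 D)
theorem3p3 (wk A D ρ)    = map-normalisable (λ X → wk A X ρ) in-wk id (theorem3p3 D)
theorem3p3 (ab A D ρ)    = map-normalisable (λ X → ab A X ρ) in-ab id (theorem3p3 D)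
theorem3p3 (ten A B D E ρ) with theorem3p3 D | theorem3p3 E
... | D' , cD' , D⟶*D' | E' , cE' , E⟶*E' =
  ten A B D' E' ρ , (cD' , cE') ,
  gmap (λ X → ten A B X E ρ) in-ten-l D⟶*D' ◅◅ gmap (λ X → ten A B D' X ρ) in-ten-r E⟶*E'
theorem3p3 (cut A D E κ) =
  cut-normalisableˡ (theorem3p3 D) λ D' cD' →
  cut-normalisableʳ (theorem3p3 E) λ E' cE' →
  cutFree-cut-normalises D' E' cD' cE' κ
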